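{- For all $A,B\in\mathcal W$: $A\leq_{\mathcal W}B$ if and only if $\Phi(A)\leq_{\mathcal G}\Phi(B)$.
   Context: For words $W,W'\in\{0,1\}^*$ write $W\leq_w W'$ iff $W'$ is a prefix of $W$. $\mathcal W$ is the set of finite subsets $A\subseteq\{0,1\}^*$ with no two distinct $W,W'\in A$ satisfying $W\leq_w W'$; $A\leq_{\mathcal W}B$ iff each $W\in A$ has some $W'\in B$ with $W\leq_w W'$. $\mathcal G$ is the set of words over the alphabet $\{\downarrow,\uparrow,0,1\}$ obtainable from the word $1$ by finitely many applications of the rewriting rules $1\to{\downarrow}11{\uparrow}$ and $1\to 0$ (each application replaces one occurrence of the left side by the right side). For $W,W'\in\mathcal G$, $W\leq_{\mathcal G}W'$ iff $W$ can be obtained from $W'$ by finitely many (possibly zero) applications of the rules $1\to{\downarrow}11{\uparrow}$, $1\to0$, ${\downarrow}00{\uparrow}\to 0$. $\Phi:\mathcal W\to\mathcal G$ is defined recursively: $\Phi(\emptyset)=0$; $\Phi(\{\varepsilon\})=1$ where $\varepsilon$ is the empty word; otherwise $\Phi(A)={\downarrow}\Phi(A_0)\Phi(A_1){\uparrow}$ (concatenation), where $A_i=\{W : iW\in A\}$ for $i\in\{0,1\}$. -}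

module Defs where

open import Data.Bool using (Bool; true; false; if_then_else_)
open import Data.Nat using (ℕ; zero; suc; _⊔_)
open import Data.List using (List; []; _∷_; _++_; length; null; foldr; mapMaybe)
open import Data.Bool.ListAction using (any)
open import Data.Maybe using (Maybe; just; nothing)
open import Data.Product using (_×_)
open import Data.List.Relation.Unary.All using (All)
open import Data.List.Relation.Unary.Any using (Any)
open import Data.List.Relation.Unary.AllPairs using (AllPairs)
open import Data.List.Relation.Binary.Prefix.Heterogeneous using (Prefix)
open import Relation.Binary.PropositionalEquality using (_≡_)
open import Relation.Binary.Construct.Closure.ReflexiveTransitive using (Star)
open import Relation.Nullary using (¬_)

Word : Set
Word = List Bool          -- false = 0, true = 1

_≤w_ : Word → Word → Set
W ≤w W' = Prefix _≡_ W' W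

-- The set 𝒲: finite antichains, represented as lists whose entries are
-- pairwise (at distinct positions) ≤w-incomparable.  In particular no
-- duplicates occur, so the list is a faithful encoding of a finite set.

IsAntichain : List Word → Set
IsAntichain = AllPairs (λ W W' → ¬ (W ≤w W') × ¬ (W' ≤w W))

_≤𝒲_ : List Word → List Word → Set
A ≤𝒲 B = All (λ W → Any (λ W' → W ≤w W') B) A

data Letter : Set where
  ↓ ↑ 𝟘 𝟙 : Letter

GWord : Set
GWord = List Letter

data Rule : GWord → GWord → Set where
  split : Rule (𝟙 ∷ []) (↓ ∷ 𝟙 ∷ 𝟙 ∷ ↑ ∷ [])
  kill  : Rule (𝟙 ∷ []) (𝟘 ∷ [])
  merge : Rule (↓ ∷ 𝟘 ∷ 𝟘 ∷ ↑ ∷ []) (𝟘 ∷ [])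

data GenRule : GWord → GWord → Set where
  split : GenRule (𝟙 ∷ []) (↓ ∷ 𝟙 ∷ 𝟙 ∷ ↑ ∷ [])
  kill  : GenRule (𝟙 ∷ []) (𝟘 ∷ [])

data Step (R : GWord → GWord → Set) : GWord → GWord → Set where
  step : ∀ x y {l r} → R l r → Step R (x ++ l ++ y) (x ++ r ++ y)

In𝒢 : GWord → Set
In𝒢 W = Star (Step GenRule) (𝟙 ∷ []) W

_≤𝒢_ : GWord → GWord → Set
W ≤𝒢 W' = Star (Step Rule) W' W

restrict : Bool → List Word → List Word
restrict i = mapMaybe f
  where
  f : Word → Maybe Word
  f []      = nothing
  f (j ∷ W) = if eqB i j then just W else nothing
    where
    eqB : Bool → Bool → Bool
    eqB true  true  = true
    eqB false false = true
    eqB _     _     = false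

maxLength : List Word → ℕ
maxLength = foldr (λ W n → length W ⊔ n) 0

-- Φ with a fuel parameter (fuel = maximal word length suffices, so
-- the final "fuel exhausted" clause is never reached on antichains).
Φ′ : ℕ → List Word → GWord
Φ′ _       []      = 𝟘 ∷ []
Φ′ n       A@(_ ∷ _) with any null A
... | true  = 𝟙 ∷ []          -- ε ∈ A; for an antichain this means A = {ε}
Φ′ zero    (_ ∷ _) | false = 𝟘 ∷ []
Φ′ (suc n) A@(_ ∷ _) | false =
  ↓ ∷ (Φ′ n (restrict false A) ++ Φ′ n (restrict true A) ++ ↑ ∷ [])

Φ : List Word → GWord
Φ A = Φ′ (maxLength A) A

-- Read a word of 𝒢 as a binary tree (↓ X Y ↑ a node, 0 and 1 leaves) and say that it
-- accepts W ∈ {0,1}* when following the bits of W from the root ends in a 1-leaf;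
-- Φ A then accepts W exactly when W has a prefix in A. Each rewriting rule can only
-- shrink the set of accepted words, so Φ A ≤𝒢 Φ B forces every W ∈ A, which Φ A
-- accepts, to be accepted by Φ B, i.e. A ≤𝒲 B. Conversely, if A ≤𝒲 B then Φ B is
-- rewritten into Φ A along the common tree structure: 1-leaves of Φ B grow into any
-- tree (split, kill) and subtrees above 0-leaves of Φ A collapse (kill, merge).
-- Acceptance is computed by a left-to-right automaton on letters so that it
-- commutes with the contexts in which rules are applied.
module Submission where

open import Defs
open import Data.List using (List)
open import Function.Bundles using (_⇔_; mk⇔)

open import Data.Bool using (Bool; true; false; if_then_else_)
open import Data.Nat using (ℕ; zero; suc; _≤_; s≤s)
open import Data.Nat.Properties using (m≤m⊔n; m≤n⊔m; ≤-trans)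
open import Data.List using ([]; _∷_; _++_; length; null; foldl)
open import Data.List.Properties using (++-assoc; foldl-++)
open import Data.Bool.ListAction using (any)
open import Data.Product using (∃; _,_)
open import Data.Sum using (_⊎_; inj₁; inj₂)
open import Data.Empty using (⊥-elim)
open import Data.List.Relation.Unary.All as All using (All; []; _∷_)
open import Data.List.Relation.Unary.Any using (Any; here; there)
open import Data.List.Relation.Binary.Prefix.Heterogeneous using ([]; _∷_)
open import Data.List.Membership.Propositional using (_∈_; find; lose)
open import Relation.Nullary using (¬_)
open import Relation.Binary.PropositionalEquality
  using (_≡_; refl; sym; trans; cong; subst₂; module ≡-Reasoning)
open import Relation.Binary.Construct.Closure.ReflexiveTransitive
  using (Star; ε; _◅_; _◅◅_; gmap)

∈-restrict⁻ : ∀ b {W} (A : List Word) → W ∈ restrict b A → (b ∷ W) ∈ A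
∈-restrict⁻ b     []                  ()
∈-restrict⁻ b     ([] ∷ A)            W∈ = there (∈-restrict⁻ b A W∈)
∈-restrict⁻ false ((false ∷ V) ∷ A)   (here refl) = here refl
∈-restrict⁻ false ((false ∷ V) ∷ A)   (there W∈)  = there (∈-restrict⁻ false A W∈)
∈-restrict⁻ false ((true ∷ V) ∷ A)    W∈          = there (∈-restrict⁻ false A W∈)
∈-restrict⁻ true  ((true ∷ V) ∷ A)    (here refl) = here refl
∈-restrict⁻ true  ((true ∷ V) ∷ A)    (there W∈)  = there (∈-restrict⁻ true A W∈)
∈-restrict⁻ true  ((false ∷ V) ∷ A)   W∈          = there (∈-restrict⁻ true A W∈)

∈-restrict⁺ : ∀ b {W} (A : List Word) → (b ∷ W) ∈ A → W ∈ restrict b A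
∈-restrict⁺ b     []                ()
∈-restrict⁺ b     ([] ∷ A)          (there bW∈) = ∈-restrict⁺ b A bW∈
∈-restrict⁺ false ((false ∷ V) ∷ A) (here refl) = here refl
∈-restrict⁺ false ((false ∷ V) ∷ A) (there bW∈) = there (∈-restrict⁺ false A bW∈)
∈-restrict⁺ false ((true ∷ V) ∷ A)  (there bW∈) = ∈-restrict⁺ false A bW∈
∈-restrict⁺ true  ((true ∷ V) ∷ A)  (here refl) = here refl
∈-restrict⁺ true  ((true ∷ V) ∷ A)  (there bW∈) = there (∈-restrict⁺ true A bW∈)
∈-restrict⁺ true  ((false ∷ V) ∷ A) (there bW∈) = ∈-restrict⁺ true A bW∈

any-null⇒ε∈ : ∀ (A : List Word) → any null A ≡ true → [] ∈ A
any-null⇒ε∈ ([] ∷ A)      _ = here refl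
any-null⇒ε∈ ((c ∷ W) ∷ A) e = there (any-null⇒ε∈ A e)

¬any-null⇒ε∉ : ∀ (A : List Word) → any null A ≡ false → ¬ [] ∈ A
¬any-null⇒ε∉ ((c ∷ W) ∷ A) e (there ε∈) = ¬any-null⇒ε∉ A e ε∈

ε∈-≤𝒲 : ∀ {A B} → [] ∈ A → A ≤𝒲 B → [] ∈ B
ε∈-≤𝒲 ε∈A A≤B with find (All.lookup A≤B ε∈A)
... | [] , ε∈B , [] = ε∈B

restrict-≤𝒲 : ∀ b {A} B → ¬ [] ∈ B → A ≤𝒲 B → restrict b A ≤𝒲 restrict b B
restrict-≤𝒲 b {A} B ε∉B A≤B = All.tabulate below
  where
  below : ∀ {W} → W ∈ restrict b A → Any (W ≤w_) (restrict b B)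
  below W∈ with find (All.lookup A≤B (∈-restrict⁻ b A W∈))
  ... | [] , ε∈B , _ = ⊥-elim (ε∉B ε∈B)
  ... | (c ∷ P) , cP∈B , refl ∷ W≤P = lose (∈-restrict⁺ b B cP∈B) W≤P

any-≤w-restrict⁻ : ∀ b {v} B → Any (v ≤w_) (restrict b B) → Any ((b ∷ v) ≤w_) B
any-≤w-restrict⁻ b B v≤ with find v≤
... | P , P∈ , v≤P = lose (∈-restrict⁻ b B P∈) (refl ∷ v≤P)

Lengths≤ : ℕ → List Word → Set
Lengths≤ n = All (λ W → length W ≤ n)

restrict-lengths≤ : ∀ b {n} B → Lengths≤ (suc n) B → Lengths≤ n (restrict b B)
restrict-lengths≤ b B bounded = All.tabulate λ W∈ → shorten (All.lookup bounded (∈-restrict⁻ b B W∈))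
  where
  shorten : ∀ {k n} → suc k ≤ suc n → k ≤ n
  shorten (s≤s k≤n) = k≤n

maxLength-lengths≤ : ∀ B → Lengths≤ (maxLength B) B
maxLength-lengths≤ []      = []
maxLength-lengths≤ (W ∷ B) =
  m≤m⊔n (length W) (maxLength B) ∷
  All.map (λ ≤max → ≤-trans ≤max (m≤n⊔m (length W) (maxLength B))) (maxLength-lengths≤ B)

branch : GWord → GWord → GWord
branch X Y = ↓ ∷ (X ++ Y ++ ↑ ∷ [])

data Φ′-View : ℕ → List Word → GWord → Set where
  empty     : ∀ {n} → Φ′-View n [] (𝟘 ∷ [])
  root      : ∀ {n A} → [] ∈ A → Φ′-View n A (𝟙 ∷ [])
  exhausted : ∀ {W A} → ¬ [] ∈ (W ∷ A) → Φ′-View zero (W ∷ A) (𝟘 ∷ [])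
  node      : ∀ {n A} → ¬ [] ∈ A →
              Φ′-View (suc n) A (branch (Φ′ n (restrict false A)) (Φ′ n (restrict true A)))

Φ′-view : ∀ n A → Φ′-View n A (Φ′ n A)
Φ′-view n       []        = empty
Φ′-view n       A@(_ ∷ _) with any null A in eq
... | true = root (any-null⇒ε∈ A eq)
Φ′-view zero    A@(_ ∷ _) | false = exhausted (¬any-null⇒ε∉ A eq)
Φ′-view (suc n) A@(_ ∷ _) | false = node (¬any-null⇒ε∉ A eq)

-- seek v: at the start of a subtree, follow v; skip d v: inside a subtree that is
-- being passed over, d node levels below its root; afterwards continue with seek v.
data State : Set where
  halt : Bool → State
  seek : Word → State
  skip : ℕ → Word → State

pattern accept = halt true
pattern reject = halt false

resume : ℕ → Word → State
resume zero    v = seek v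
resume (suc d) v = skip (suc d) v

δ : State → Letter → State
δ (halt b)           _ = halt b
δ (seek v)           𝟙 = accept
δ (seek v)           𝟘 = reject
δ (seek v)           ↑ = reject
δ (seek [])          ↓ = reject
δ (seek (false ∷ v)) ↓ = seek v
δ (seek (true ∷ v))  ↓ = skip 0 v
δ (skip d v)         ↓ = skip (suc d) v
δ (skip d v)         𝟘 = resume d v
δ (skip d v)         𝟙 = resume d v
δ (skip zero v)      ↑ = reject
δ (skip (suc d) v)   ↑ = resume d v

run : State → GWord → State
run = foldl δ

run-halt : ∀ b X → run (halt b) X ≡ halt b
run-halt b []      = refl
run-halt b (_ ∷ X) = run-halt b X

run-branch : ∀ s X Y → run s (branch X Y) ≡ δ (run (run (δ s ↓) X) Y) ↑
run-branch s X Y = trans (foldl-++ δ (δ s ↓) X (Y ++ ↑ ∷ [])) (foldl-++ δ (run (δ s ↓) X) Y (↑ ∷ []))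

Skips : GWord → Set
Skips X = ∀ d v → run (skip d v) X ≡ resume d v

Halts : GWord → Set
Halts X = ∀ v → ∃ λ b → run (seek v) X ≡ halt b

branch-skips : ∀ X Y → Skips X → Skips Y → Skips (branch X Y)
branch-skips X Y X-skips Y-skips d v = begin
  run (skip d v) (branch X Y)                     ≡⟨ run-branch (skip d v) X Y ⟩
  δ (run (run (skip (suc d) v) X) Y) ↑            ≡⟨ cong (λ s → δ (run s Y) ↑) (X-skips (suc d) v) ⟩
  δ (run (skip (suc d) v) Y) ↑                    ≡⟨ cong (λ s → δ s ↑) (Y-skips (suc d) v) ⟩
  resume d v                                      ∎
  where open ≡-Reasoning

seek-branch-ε : ∀ X Y → run (seek []) (branch X Y) ≡ reject
seek-branch-ε X Y = begin
  run (seek []) (branch X Y)     ≡⟨ run-branch (seek []) X Y ⟩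
  δ (run (run reject X) Y) ↑     ≡⟨ cong (λ s → δ (run s Y) ↑) (run-halt false X) ⟩
  δ (run reject Y) ↑             ≡⟨ cong (λ s → δ s ↑) (run-halt false Y) ⟩
  reject                         ∎
  where open ≡-Reasoning

seek-branch : ∀ X Y → Skips X → Halts X → Halts Y →
              ∀ b v → run (seek (b ∷ v)) (branch X Y) ≡ run (seek v) (if b then Y else X)
seek-branch X Y X-skips X-halts Y-halts false v with X-halts v
... | c , X-halts-c = begin
  run (seek (false ∷ v)) (branch X Y)  ≡⟨ run-branch (seek (false ∷ v)) X Y ⟩
  δ (run (run (seek v) X) Y) ↑         ≡⟨ cong (λ s → δ (run s Y) ↑) X-halts-c ⟩
  δ (run (halt c) Y) ↑                 ≡⟨ cong (λ s → δ s ↑) (run-halt c Y) ⟩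
  halt c                               ≡⟨ sym X-halts-c ⟩
  run (seek v) X                       ∎
  where open ≡-Reasoning
seek-branch X Y X-skips X-halts Y-halts true v with Y-halts v
... | c , Y-halts-c = begin
  run (seek (true ∷ v)) (branch X Y)   ≡⟨ run-branch (seek (true ∷ v)) X Y ⟩
  δ (run (run (skip 0 v) X) Y) ↑       ≡⟨ cong (λ s → δ (run s Y) ↑) (X-skips 0 v) ⟩
  δ (run (seek v) Y) ↑                 ≡⟨ cong (λ s → δ s ↑) Y-halts-c ⟩
  halt c                               ≡⟨ sym Y-halts-c ⟩
  run (seek v) Y                       ∎
  where open ≡-Reasoning

branch-halts : ∀ X Y → Skips X → Halts X → Halts Y → Halts (branch X Y)
branch-halts X Y _       _       _       []          = false , seek-branch-ε X Y
branch-halts X Y X-skips X-halts Y-halts (false ∷ v) with X-halts v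
... | c , X-halts-c = c , trans (seek-branch X Y X-skips X-halts Y-halts false v) X-halts-c
branch-halts X Y X-skips X-halts Y-halts (true ∷ v) with Y-halts v
... | c , Y-halts-c = c , trans (seek-branch X Y X-skips X-halts Y-halts true v) Y-halts-c

Φ′-skips : ∀ n A → Skips (Φ′ n A)
Φ′-skips n A with Φ′ n A | Φ′-view n A
... | _ | empty       = λ _ _ → refl
... | _ | root _      = λ _ _ → refl
... | _ | exhausted _ = λ _ _ → refl
Φ′-skips (suc n) A | _ | node _ =
  branch-skips (Φ′ n (restrict false A)) (Φ′ n (restrict true A))
    (Φ′-skips n (restrict false A)) (Φ′-skips n (restrict true A))

Φ′-halts : ∀ n A → Halts (Φ′ n A)
Φ′-halts n A with Φ′ n A | Φ′-view n A
... | _ | empty       = λ _ → false , refl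
... | _ | root _      = λ _ → true , refl
... | _ | exhausted _ = λ _ → false , refl
Φ′-halts (suc n) A | _ | node _ =
  branch-halts (Φ′ n (restrict false A)) (Φ′ n (restrict true A))
    (Φ′-skips n (restrict false A)) (Φ′-halts n (restrict false A)) (Φ′-halts n (restrict true A))

seek-Φ′-branch : ∀ n A b v →
  run (seek (b ∷ v)) (branch (Φ′ n (restrict false A)) (Φ′ n (restrict true A))) ≡
  run (seek v) (Φ′ n (restrict b A))
seek-Φ′-branch n A b v = trans
  (seek-branch X Y (Φ′-skips n (restrict false A)) (Φ′-halts n (restrict false A)) (Φ′-halts n (restrict true A)) b v)
  (cong (run (seek v)) (child b))
  where
  X = Φ′ n (restrict false A)
  Y = Φ′ n (restrict true A)
  child : ∀ b → (if b then Y else X) ≡ Φ′ n (restrict b A)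
  child false = refl
  child true  = refl

member-accepted : ∀ n A {W} → W ∈ A → length W ≤ n → run (seek W) (Φ′ n A) ≡ accept
member-accepted n A W∈A _ with Φ′ n A | Φ′-view n A
member-accepted n .[] () _ | _ | empty
... | _ | root _ = refl
member-accepted zero _ {[]}    ε∈A _ | _ | exhausted ε∉A = ⊥-elim (ε∉A ε∈A)
member-accepted zero _ {_ ∷ _} _   () | _ | exhausted _
member-accepted (suc n) A {[]}    ε∈A _ | _ | node ε∉A = ⊥-elim (ε∉A ε∈A)
member-accepted (suc n) A {b ∷ W} bW∈A (s≤s W≤n) | _ | node _ =
  trans (seek-Φ′-branch n A b W) (member-accepted n (restrict b A) (∈-restrict⁺ b A bW∈A) W≤n)

accepted-prefix : ∀ n B v → run (seek v) (Φ′ n B) ≡ accept → Any (v ≤w_) B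
accepted-prefix n B v accepts with Φ′ n B | Φ′-view n B
accepted-prefix n B v () | _ | empty
... | _ | root ε∈B = lose ε∈B []
accepted-prefix n B v () | _ | exhausted _
accepted-prefix (suc n) B [] accepts | _ | node _
  with () ← trans (sym (seek-branch-ε (Φ′ n (restrict false B)) (Φ′ n (restrict true B)))) accepts
accepted-prefix (suc n) B (b ∷ v) accepts | _ | node _ =
  any-≤w-restrict⁻ b B (accepted-prefix n (restrict b B) v (trans (sym (seek-Φ′-branch n B b v)) accepts))

infix 4 _⇒*_
_⇒*_ : GWord → GWord → Set
_⇒*_ = Star (Step Rule)

_⊑_ : State → State → Set
s ⊑ t = s ≡ reject ⊎ s ≡ t

⊑-trans : ∀ {s t u} → s ⊑ t → t ⊑ u → s ⊑ u
⊑-trans (inj₁ s-rejects) _ = inj₁ s-rejects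
⊑-trans (inj₂ refl)      t⊑u = t⊑u

run-⊑ : ∀ {s t} X → s ⊑ t → run s X ⊑ run t X
run-⊑ X (inj₁ refl) = inj₁ (run-halt false X)
run-⊑ X (inj₂ refl) = inj₂ refl

rule-⊑ : ∀ {l r} → Rule l r → ∀ s → run s r ⊑ run s l
rule-⊑ split (halt b)           = inj₂ refl
rule-⊑ split (seek [])          = inj₁ refl
rule-⊑ split (seek (false ∷ v)) = inj₂ refl
rule-⊑ split (seek (true ∷ v))  = inj₂ refl
rule-⊑ split (skip d v)         = inj₂ refl
rule-⊑ kill  (halt b)           = inj₂ refl
rule-⊑ kill  (seek v)           = inj₁ refl
rule-⊑ kill  (skip d v)         = inj₂ refl
rule-⊑ merge (halt b)           = inj₂ refl
rule-⊑ merge (seek v)           = inj₁ refl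
rule-⊑ merge (skip d v)         = inj₂ refl

step-⊑ : ∀ {X Y} → Step Rule X Y → ∀ s → run s Y ⊑ run s X
step-⊑ (step x y {l} {r} l→r) s =
  subst₂ _⊑_ (sym (run-context r)) (sym (run-context l)) (run-⊑ y (rule-⊑ l→r (run s x)))
  where
  run-context : ∀ z → run s (x ++ z ++ y) ≡ run (run (run s x) z) y
  run-context z = trans (foldl-++ δ s x (z ++ y)) (foldl-++ δ (run s x) z y)

⇒*-⊑ : ∀ {X Y} → X ⇒* Y → ∀ s → run s Y ⊑ run s X
⇒*-⊑ ε                s = inj₂ refl
⇒*-⊑ (X→X′ ◅ X′⇒*Y) s = ⊑-trans (⇒*-⊑ X′⇒*Y s) (step-⊑ X→X′ s)

⇒*-reflects-accept : ∀ {X Y s} → X ⇒* Y → run s Y ≡ accept → run s X ≡ accept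
⇒*-reflects-accept {s = s} X⇒*Y Y-accepts with ⇒*-⊑ X⇒*Y s
... | inj₁ Y-rejects = ⊥-elim (accept≢reject (trans (sym Y-accepts) Y-rejects))
  where
  accept≢reject : ¬ accept ≡ reject
  accept≢reject ()
... | inj₂ same = trans (sym same) Y-accepts

step-context : ∀ p q {X Y} → Step Rule X Y → Step Rule (p ++ X ++ q) (p ++ Y ++ q)
step-context p q (step x y {l} {r} l→r) = subst₂ (Step Rule) (reassoc l) (reassoc r) (step (p ++ x) (y ++ q) l→r)
  where
  open ≡-Reasoning
  reassoc : ∀ z → (p ++ x) ++ z ++ y ++ q ≡ p ++ (x ++ z ++ y) ++ q
  reassoc z = begin
    (p ++ x) ++ z ++ y ++ q    ≡⟨ ++-assoc p x (z ++ y ++ q) ⟩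
    p ++ x ++ z ++ y ++ q      ≡⟨ cong (λ t → p ++ x ++ t) (++-assoc z y q) ⟨
    p ++ x ++ (z ++ y) ++ q    ≡⟨ cong (p ++_) (++-assoc x (z ++ y) q) ⟨
    p ++ (x ++ z ++ y) ++ q    ∎

⇒*-context : ∀ p q {X Y} → X ⇒* Y → (p ++ X ++ q) ⇒* (p ++ Y ++ q)
⇒*-context p q = gmap (λ X → p ++ X ++ q) (step-context p q)

⇒*-branch : ∀ {X X′ Y Y′} → X ⇒* X′ → Y ⇒* Y′ → branch X Y ⇒* branch X′ Y′
⇒*-branch {X′ = X′} {Y = Y} X⇒*X′ Y⇒*Y′ =
  ⇒*-context (↓ ∷ []) (Y ++ ↑ ∷ []) X⇒*X′ ◅◅ ⇒*-context (↓ ∷ X′) (↑ ∷ []) Y⇒*Y′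

apply : ∀ {l r} → Rule l r → l ⇒* r
apply split = step [] [] split ◅ ε
apply kill  = step [] [] kill ◅ ε
apply merge = step [] [] merge ◅ ε

branch⇒*𝟘 : ∀ {X Y} → X ⇒* 𝟘 ∷ [] → Y ⇒* 𝟘 ∷ [] → branch X Y ⇒* 𝟘 ∷ []
branch⇒*𝟘 X⇒*𝟘 Y⇒*𝟘 = ⇒*-branch X⇒*𝟘 Y⇒*𝟘 ◅◅ apply merge

𝟙⇒*Φ′ : ∀ n A → 𝟙 ∷ [] ⇒* Φ′ n A
𝟙⇒*Φ′ n A with Φ′ n A | Φ′-view n A
... | _ | empty       = apply kill
... | _ | root _      = ε
... | _ | exhausted _ = apply kill
𝟙⇒*Φ′ (suc n) A | _ | node _ =
  apply split ◅◅ ⇒*-branch (𝟙⇒*Φ′ n (restrict false A)) (𝟙⇒*Φ′ n (restrict true A))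

Φ′⇒*𝟘 : ∀ n A → Φ′ n A ⇒* 𝟘 ∷ []
Φ′⇒*𝟘 n A with Φ′ n A | Φ′-view n A
... | _ | empty       = ε
... | _ | root _      = apply kill
... | _ | exhausted _ = ε
Φ′⇒*𝟘 (suc n) A | _ | node _ = branch⇒*𝟘 (Φ′⇒*𝟘 n (restrict false A)) (Φ′⇒*𝟘 n (restrict true A))

Φ′-≤𝒲⇒ : ∀ n m A B → Lengths≤ n B → A ≤𝒲 B → Φ′ n B ⇒* Φ′ m A
Φ′-≤𝒲⇒ n m A B bounded A≤B with Φ′ n B | Φ′-view n B
Φ′-≤𝒲⇒ n m []      .[] _ _          | _ | empty = ε
Φ′-≤𝒲⇒ n m (_ ∷ _) .[] _ (() ∷ _)   | _ | empty
... | _ | root _ = 𝟙⇒*Φ′ m A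
Φ′-≤𝒲⇒ zero m A ([] ∷ B)    _          _ | _ | exhausted ε∉B = ⊥-elim (ε∉B (here refl))
Φ′-≤𝒲⇒ zero m A ((_ ∷ _) ∷ B) (() ∷ _) _ | _ | exhausted _
Φ′-≤𝒲⇒ (suc n) m A B bounded A≤B | _ | node ε∉B with Φ′ m A | Φ′-view m A
... | _ | empty       = branch⇒*𝟘 (Φ′⇒*𝟘 n (restrict false B)) (Φ′⇒*𝟘 n (restrict true B))
... | _ | root ε∈A    = ⊥-elim (ε∉B (ε∈-≤𝒲 ε∈A A≤B))
... | _ | exhausted _ = branch⇒*𝟘 (Φ′⇒*𝟘 n (restrict false B)) (Φ′⇒*𝟘 n (restrict true B))
Φ′-≤𝒲⇒ (suc n) (suc m) A B bounded A≤B | _ | node ε∉B | _ | node _ =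
  ⇒*-branch (child false) (child true)
  where
  child : ∀ b → Φ′ n (restrict b B) ⇒* Φ′ m (restrict b A)
  child b = Φ′-≤𝒲⇒ n m (restrict b A) (restrict b B) (restrict-lengths≤ b B bounded) (restrict-≤𝒲 b B ε∉B A≤B)

mainTheorem9 : (A B : List Word) → IsAntichain A → IsAntichain B → ((A ≤𝒲 B) ⇔ (Φ A ≤𝒢 Φ B))
mainTheorem9 A B _ _ =
  mk⇔ (Φ′-≤𝒲⇒ (maxLength B) (maxLength A) A B (maxLength-lengths≤ B)) ≤𝒢⇒≤𝒲
  where
  ≤𝒢⇒≤𝒲 : Φ A ≤𝒢 Φ B → A ≤𝒲 B
  ≤𝒢⇒≤𝒲 ΦB⇒*ΦA = All.tabulate λ {W} W∈A →
    accepted-prefix (maxLength B) B W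
      (⇒*-reflects-accept ΦB⇒*ΦA
        (member-accepted (maxLength A) A W∈A (All.lookup (maxLength-lengths≤ A) W∈A)))
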